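{- Let $f\colon\mathbb{F}_2^k\to\mathbb{F}_2$ and $g\colon\mathbb{F}_2^l\to\mathbb{F}_2$ be Boolean functions. Assume that there exists an integer $n$ with $k+l\leq n+1$ such that the maps $F,G\colon\mathbb{F}_2^n\to\mathbb{F}_2^n$ induced by $f$ and $g$ are each other's inverses. Then $f$ is a $(k,m)$-lifting for every $m\geq k$ and $g$ is an $(l,m)$-lifting for every $m\geq l$; that is, $f$ and $g$ are both locally invertible.
   Context: For a Boolean function $f\colon\mathbb{F}_2^k\to\mathbb{F}_2$ and an integer $m\geq k$, the map induced by $f$ on $\mathbb{F}_2^m$ is $F\colon\mathbb{F}_2^m\to\mathbb{F}_2^m$ whose $i$-th coordinate is $F(x)_i=f(x_i,x_{i+1},\dotsc,x_{i+k-1})$ for $1\le i\le m$, where indices are taken modulo $m$ in $\{1,\dots,m\}$. The function $f$ is called a $(k,m)$-lifting if this induced map is a bijection of $\mathbb{F}_2^m$. The function $f$ is called locally invertible if it is a $(k,m)$-lifting for every $m\geq k$. -}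

module Defs where

open import Data.Bool using (Bool)
open import Data.Nat using (ℕ; _+_; _%_; NonZero)
open import Data.Nat.DivMod using (m%n<n)
open import Data.Fin using (Fin; toℕ; fromℕ<)
open import Data.Vec using (Vec; tabulate; lookup)
open import Relation.Binary.PropositionalEquality using (_≡_)
open import Function.Definitions using (Bijective)

-- 𝔽₂ is modelled by Bool; 𝔽₂^k by Vec Bool k.
BoolFun : ℕ → Set
BoolFun k = Vec Bool k → Bool

shiftIdx : (m : ℕ) → .{{_ : NonZero m}} → Fin m → ℕ → Fin m
shiftIdx m i j = fromℕ< (m%n<n (toℕ i + j) m)

-- the map 𝔽₂^m → 𝔽₂^m induced by f : 𝔽₂^k → 𝔽₂:
-- F(x)_i = f(x_i, x_{i+1}, …, x_{i+k-1}), indices modulo m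
induced : ∀ {k} → BoolFun k → (m : ℕ) → .{{_ : NonZero m}} → Vec Bool m → Vec Bool m
induced {k} f m x = tabulate λ i → f (tabulate λ (j : Fin k) → lookup x (shiftIdx m i (toℕ j)))

IsLifting : ∀ {k} → BoolFun k → (m : ℕ) → .{{_ : NonZero m}} → Set
IsLifting f m = Bijective _≡_ _≡_ (induced f m)

{-# OPTIONS --safe #-}
-- The i-th coordinate of G ∘ F on 𝔽₂^m is a single rule h = g ∘ (f, …, f), in k + l − 1
-- variables, applied to the cyclic sequence x_i, x_{i+1}, …; the rule does not depend on m.
-- Since k + l − 1 ≤ n, every finite sequence of that length occurs as a window of some
-- x ∈ 𝔽₂^n, so G ∘ F = id on 𝔽₂^n forces h to be the first projection.  Then G ∘ F = id
-- on 𝔽₂^m for every m, and symmetrically F ∘ G = id, so F is a bijection with inverse G.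
module Submission where

open import Defs
open import Data.Bool using (Bool)
open import Data.Nat using (ℕ; _+_; _≤_; _<_; _%_; NonZero; suc; s≤s⁻¹; >-nonZero⁻¹)
open import Data.Nat.Properties using (+-assoc; +-comm; +-suc; +-identityʳ; +-mono-≤; ≤-trans; ≤-reflexive)
open import Data.Nat.DivMod using (m%n%n≡m%n; %-distribˡ-+; m<n⇒m%n≡m; m%n<n)
open import Data.Fin using (Fin; toℕ; fromℕ<)
open import Data.Fin.Properties using (toℕ-fromℕ<; toℕ-injective; toℕ<n)
open import Data.Vec using (Vec; tabulate; lookup)
open import Data.Vec.Properties using (lookup∘tabulate; tabulate∘lookup; tabulate-cong)
open import Data.Product using (_×_; _,_)
open import Relation.Binary.PropositionalEquality using (_≡_; refl; sym; trans; cong; module ≡-Reasoning)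
open import Function.Consequences using (inverseᵇ⇒bijective)
open import Function.Consequences.Propositional using (strictlyInverseˡ⇒inverseˡ; strictlyInverseʳ⇒inverseʳ)

[m%n+k]%n≡[m+k]%n : ∀ m k n .{{_ : NonZero n}} → (m % n + k) % n ≡ (m + k) % n
[m%n+k]%n≡[m+k]%n m k n = begin
  (m % n + k) % n         ≡⟨ %-distribˡ-+ (m % n) k n ⟩
  (m % n % n + k % n) % n ≡⟨ cong (λ r → (r + k % n) % n) (m%n%n≡m%n m n) ⟩
  (m % n + k % n) % n     ≡⟨ %-distribˡ-+ m k n ⟨
  (m + k) % n             ∎
  where open ≡-Reasoning

toℕ-shiftIdx : ∀ m .{{_ : NonZero m}} (i : Fin m) j → toℕ (shiftIdx m i j) ≡ (toℕ i + j) % m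
toℕ-shiftIdx m i j = toℕ-fromℕ< (m%n<n (toℕ i + j) m)

shiftIdx-+ : ∀ m .{{_ : NonZero m}} (i : Fin m) a b →
             shiftIdx m (shiftIdx m i a) b ≡ shiftIdx m i (a + b)
shiftIdx-+ m i a b = toℕ-injective (begin
  toℕ (shiftIdx m (shiftIdx m i a) b) ≡⟨ toℕ-shiftIdx m (shiftIdx m i a) b ⟩
  (toℕ (shiftIdx m i a) + b) % m      ≡⟨ cong (λ r → (r + b) % m) (toℕ-shiftIdx m i a) ⟩
  ((toℕ i + a) % m + b) % m           ≡⟨ [m%n+k]%n≡[m+k]%n (toℕ i + a) b m ⟩
  (toℕ i + a + b) % m                 ≡⟨ cong (_% m) (+-assoc (toℕ i) a b) ⟩
  (toℕ i + (a + b)) % m               ≡⟨ toℕ-shiftIdx m i (a + b) ⟨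
  toℕ (shiftIdx m i (a + b))          ∎)
  where open ≡-Reasoning

shiftIdx-identityʳ : ∀ m .{{_ : NonZero m}} (i : Fin m) → shiftIdx m i 0 ≡ i
shiftIdx-identityʳ m i = toℕ-injective (begin
  toℕ (shiftIdx m i 0) ≡⟨ toℕ-shiftIdx m i 0 ⟩
  (toℕ i + 0) % m      ≡⟨ cong (_% m) (+-identityʳ (toℕ i)) ⟩
  toℕ i % m            ≡⟨ m<n⇒m%n≡m (toℕ<n i) ⟩
  toℕ i                ∎)
  where open ≡-Reasoning

cyclicFrom : ∀ {m} .{{_ : NonZero m}} → Vec Bool m → Fin m → ℕ → Bool
cyclicFrom {m} x i j = lookup x (shiftIdx m i j)

composeRule : ∀ {k l} → BoolFun k → BoolFun l → (ℕ → Bool) → Bool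
composeRule {k} {l} f g s =
  g (tabulate λ (a : Fin l) → f (tabulate λ (b : Fin k) → s (toℕ a + toℕ b)))

lookup-induced-∘ : ∀ {k l} (f : BoolFun k) (g : BoolFun l) m .{{_ : NonZero m}} x (i : Fin m) →
                   lookup (induced g m (induced f m x)) i ≡ composeRule f g (cyclicFrom x i)
lookup-induced-∘ {k} {l} f g m x i = begin
  lookup (induced g m (induced f m x)) i
    ≡⟨ lookup∘tabulate _ i ⟩
  g (tabulate λ (a : Fin l) → lookup (induced f m x) (shiftIdx m i (toℕ a)))
    ≡⟨ cong g (tabulate-cong λ a → lookup∘tabulate _ (shiftIdx m i (toℕ a))) ⟩
  g (tabulate λ (a : Fin l) → f (tabulate λ (b : Fin k) →
      lookup x (shiftIdx m (shiftIdx m i (toℕ a)) (toℕ b))))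
    ≡⟨ cong g (tabulate-cong λ a → cong f (tabulate-cong λ b →
         cong (lookup x) (shiftIdx-+ m i (toℕ a) (toℕ b)))) ⟩
  composeRule f g (cyclicFrom x i)
    ∎
  where open ≡-Reasoning

composeRule-cong : ∀ {k l} (f : BoolFun k) (g : BoolFun l) {s s' : ℕ → Bool} →
                   (∀ j → suc j < k + l → s j ≡ s' j) → composeRule f g s ≡ composeRule f g s'
composeRule-cong {k} {l} f g agree =
  cong g (tabulate-cong λ a → cong f (tabulate-cong λ b →
    agree (toℕ a + toℕ b) (index-bound (toℕ<n a) (toℕ<n b))))
  where
  index-bound : ∀ {a b} → a < l → b < k → suc (a + b) < k + l
  index-bound {a} {b} a<l b<k = ≤-trans (≤-reflexive (cong suc (sym (+-suc a b))))
                                        (≤-trans (+-mono-≤ a<l b<k) (≤-reflexive (+-comm l k)))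

composeRule-head : ∀ {k l} n .{{_ : NonZero n}} (f : BoolFun k) (g : BoolFun l) → k + l ≤ suc n →
                   (∀ x → induced g n (induced f n x) ≡ x) → ∀ s → composeRule f g s ≡ s 0
composeRule-head n f g k+l≤1+n gf s = begin
  composeRule f g s                 ≡⟨ composeRule-cong f g (λ j 1+j<k+l →
                                         sym (cyclicFrom-y (s≤s⁻¹ (≤-trans 1+j<k+l k+l≤1+n)))) ⟩
  composeRule f g (cyclicFrom y i₀) ≡⟨ lookup-induced-∘ f g n y i₀ ⟨
  lookup (induced g n (induced f n y)) i₀ ≡⟨ cong (λ v → lookup v i₀) (gf y) ⟩
  lookup y i₀                       ≡⟨ cong (lookup y) (shiftIdx-identityʳ n i₀) ⟨
  cyclicFrom y i₀ 0                 ≡⟨ cyclicFrom-y (>-nonZero⁻¹ n) ⟩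
  s 0                               ∎
  where
  open ≡-Reasoning
  y : Vec Bool n
  y = tabulate λ p → s (toℕ p)
  i₀ : Fin n
  i₀ = fromℕ< (>-nonZero⁻¹ n)
  cyclicFrom-y : ∀ {j} → j < n → cyclicFrom y i₀ j ≡ s j
  cyclicFrom-y {j} j<n = trans (lookup∘tabulate _ (shiftIdx n i₀ j)) (cong s (begin
    toℕ (shiftIdx n i₀ j) ≡⟨ toℕ-shiftIdx n i₀ j ⟩
    (toℕ i₀ + j) % n      ≡⟨ cong (λ r → (r + j) % n) (toℕ-fromℕ< (>-nonZero⁻¹ n)) ⟩
    j % n                 ≡⟨ m<n⇒m%n≡m j<n ⟩
    j                     ∎))

induced-∘-identity : ∀ {k l} (f : BoolFun k) (g : BoolFun l) → (∀ s → composeRule f g s ≡ s 0) →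
                     ∀ m .{{_ : NonZero m}} x → induced g m (induced f m x) ≡ x
induced-∘-identity f g head m x = begin
  induced g m (induced f m x)                          ≡⟨ tabulate∘lookup _ ⟨
  tabulate (lookup (induced g m (induced f m x)))      ≡⟨ tabulate-cong lookup-GFx ⟩
  tabulate (lookup x)                                  ≡⟨ tabulate∘lookup x ⟩
  x                                                    ∎
  where
  open ≡-Reasoning
  lookup-GFx : ∀ i → lookup (induced g m (induced f m x)) i ≡ lookup x i
  lookup-GFx i = trans (lookup-induced-∘ f g m x i)
                       (trans (head (cyclicFrom x i)) (cong (lookup x) (shiftIdx-identityʳ m i)))

isLifting-of-inverse : ∀ {k l} (f : BoolFun k) (g : BoolFun l) m .{{_ : NonZero m}} →
                       (∀ x → induced g m (induced f m x) ≡ x) →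
                       (∀ y → induced f m (induced g m y) ≡ y) → IsLifting f m
isLifting-of-inverse f g m gf fg = inverseᵇ⇒bijective _≡_ refl sym trans
  (strictlyInverseˡ⇒inverseˡ {f⁻¹ = induced g m} (induced f m) fg ,
   strictlyInverseʳ⇒inverseʳ {f⁻¹ = induced g m} (induced f m) gf)

mainTheorem1 : (k l n : ℕ) → .{{_ : NonZero n}} → (f : BoolFun k) → (g : BoolFun l) →
    k + l ≤ suc n →
    (∀ x → induced g n (induced f n x) ≡ x) →
    (∀ y → induced f n (induced g n y) ≡ y) →
    ((m : ℕ) → .{{_ : NonZero m}} → k ≤ m → IsLifting f m) ×
    ((m : ℕ) → .{{_ : NonZero m}} → l ≤ m → IsLifting g m)
mainTheorem1 k l n f g k+l≤1+n gf fg =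
  (λ m _ → isLifting-of-inverse f g m (GF-id m) (FG-id m)) ,
  (λ m _ → isLifting-of-inverse g f m (FG-id m) (GF-id m))
  where
  l+k≤1+n : l + k ≤ suc n
  l+k≤1+n = ≤-trans (≤-reflexive (+-comm l k)) k+l≤1+n
  GF-id : ∀ m .{{_ : NonZero m}} x → induced g m (induced f m x) ≡ x
  GF-id = induced-∘-identity f g (composeRule-head n f g k+l≤1+n gf)
  FG-id : ∀ m .{{_ : NonZero m}} y → induced f m (induced g m y) ≡ y
  FG-id = induced-∘-identity g f (composeRule-head n g f l+k≤1+n fg)
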